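{- For any atom $p(x_1,\dots,x_n)$ of the many-valued logic program $PR$, any world $w\in\mathcal{W}$ and any assignment $g$, it holds that $\mathcal{M}\models_{w,g}\mathcal{E}(p(x_1,\dots,x_n))$ if and only if the modal atom $[w]p(g(x_1),\dots,g(x_n))$ is true in $\mathcal{M}_I$.
   Context: Let $PR$ be a many-valued logic program. Its algebraic truth values form a bounded lattice $\mathcal{W}$ with $\mathbf{2}=\{0,1\}\subseteq\mathcal{W}$. $P$ is its set of predicate symbols, $H$ its Herbrand base, and $I_{mv}:H\to\mathcal{W}$ a many-valued Herbrand model of $PR$. $S$ is a nonempty set of constants. (Unary modal transformation.) For each $\alpha\in\mathcal{W}$ there is a universal modal operator $[\alpha]$ with accessibility relation $\mathcal{R}_\alpha=\mathcal{W}\times\{\alpha\}$. The Kripke model is $\mathcal{M}_I=(\mathcal{W},\{\mathcal{R}_w\mid w\in\mathcal{W}\},S,V)$, where $V(w,p)(c_1,\dots,c_n)=1$ iff $w=I_{mv}(p(c_1,\dots,c_n))$. Its satisfaction relation is: - $\mathcal{M}_I\models_{g,w}p(x_1,\dots,x_n)$ iff $V(w,p)(g(x_1),\dots,g(x_n))=1$; - $\mathcal{M}_I\models_{g,w}[\alpha]p(x_1,\dots,x_n)$ iff $\mathcal{M}_I\models_{g,y}p(x_1,\dots,x_n)$ for every $y$ with $(w,y)\in\mathcal{R}_\alpha$. A ground formula is true in $\mathcal{M}_I$ if it is satisfied at every world. (Ontological encapsulation / flattening.) For each predicate $p$, a built-in function $\kappa_p$ is defined by $\kappa_p(c_1,\dots,c_n)=I_{mv}(p(c_1,\dots,c_n))$.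 Each atom is translated as $\mathcal{E}(p(t_1,\dots,t_n))=p_F(t_1,\dots,t_n,\kappa_p(t_1,\dots,t_n))$, where $p_F$ extends $p$ by one extra attribute with values in $\mathcal{W}$. The Kripke-style model $\mathcal{M}$ of the flattened program has set of worlds $\mathcal{W}$ and valuation $V(w,p_F)(c_1,\dots,c_n,\alpha)=1$ iff $w=\alpha=\kappa_p(c_1,\dots,c_n)$. Its satisfaction on such atoms is $\mathcal{M}\models_{w,g}p_F(x_1,\dots,x_n,\alpha)$ iff $V(w,p_F)(g(x_1),\dots,g(x_n),\alpha)=1$. Its remaining components are ternary accessibility relations for the binary modal operators $\wedge^A,\vee^A,\leftarrow^A$, a binary relation for $\sim^A$, and $\mathcal{R}_\times=\mathcal{W}\times\mathcal{W}$. -}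

module Defs where

open import Level using (0ℓ)
open import Data.Nat using (ℕ)
open import Data.Vec using (Vec; map)
open import Data.Product using (Σ; _×_; _,_)
open import Relation.Binary.PropositionalEquality using (_≡_)
open import Relation.Binary.Core using (Rel)
open import Relation.Binary.Lattice.Structures using (IsBoundedLattice)

-- A many-valued logic program PR, as far as the statement needs it:
-- truth-value lattice W (bounded lattice; 𝟐 = {⊥,⊤} ⊆ W), predicate
-- symbols with arities, a nonempty set S of constants, and a
-- many-valued Herbrand model I_mv : H → W.
record MVProgram : Set₁ where
  field
    W        : Set
    _≤W_     : Rel W 0ℓ
    _∨W_ _∧W_ : W → W → W
    ⊤W ⊥W    : W
    isBoundedLattice : IsBoundedLattice _≡_ _≤W_ _∨W_ _∧W_ ⊤W ⊥W
    Pred     : Set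
    arity    : Pred → ℕ
    S        : Set
    s₀       : S          -- S nonempty
    Imv      : (p : Pred) → Vec S (arity p) → W

  H : Set
  H = Σ Pred (λ p → Vec S (arity p))

module Semantics (PR : MVProgram) where
  open MVProgram PR

  data Term (X : Set) : Set where
    var : X → Term X
    con : S → Term X

  Assignment : Set → Set
  Assignment X = X → S

  eval : {X : Set} → Assignment X → Term X → S
  eval g (var x) = g x
  eval g (con c) = c

  R : W → W → W → Set
  R α w y = y ≡ α

  V-I : W → (p : Pred) → Vec S (arity p) → Set
  V-I w p cs = w ≡ Imv p cs

  data MAtom (X : Set) : Set where
    atom : (p : Pred) → Vec (Term X) (arity p) → MAtom X
    box  : W → (p : Pred) → Vec (Term X) (arity p) → MAtom X

  satI : {X : Set} → Assignment X → W → MAtom X → Set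
  satI g w (atom p ts)  = V-I w p (map (eval g) ts)
  satI g w (box α p ts) = (y : W) → R α w y → V-I y p (map (eval g) ts)

  TrueI : {X : Set} → MAtom X → Set
  TrueI {X} φ = (g : Assignment X) (w : W) → satI g w φ

  κ : (p : Pred) → Vec S (arity p) → W
  κ p cs = Imv p cs

  -- the extra attribute of p_F: a W-constant or a built-in κ_p(t₁..tₙ)
  data WTerm (X : Set) : Set where
    wcon  : W → WTerm X
    kappa : (p : Pred) → Vec (Term X) (arity p) → WTerm X

  evalW : {X : Set} → Assignment X → WTerm X → W
  evalW g (wcon α)     = α
  evalW g (kappa p ts) = κ p (map (eval g) ts)

  data FAtom (X : Set) : Set where
    pF : (p : Pred) → Vec (Term X) (arity p) → WTerm X → FAtom X

  E : {X : Set} → (p : Pred) → Vec (Term X) (arity p) → FAtom X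
  E p ts = pF p ts (kappa p ts)

  V-F : W → (p : Pred) → Vec S (arity p) → W → Set
  V-F w p cs α = (w ≡ α) × (α ≡ κ p cs)

  satF : {X : Set} → W → Assignment X → FAtom X → Set
  satF w g (pF p ts τ) = V-F w p (map (eval g) ts) (evalW g τ)

module Submission where

-- Both sides reduce to the same equation w ≡ I_mv(p(g(x₁)..g(xₙ))):
--   * flattening: p_F(t⃗, κ_p(t⃗)) holds at w iff w is the value κ_p(t⃗),
--     because the second conjunct of V-F (α ≡ κ_p(c⃗) with α := κ_p(c⃗)) is
--     trivially satisfied;
--   * box: since R_α = W × {α}, the only world reachable from any world is α,
--     so [α]p(t⃗) holds at any w iff p(t⃗) holds at α, i.e. α ≡ I_mv(p(c⃗));
--     for ground arguments this does not depend on the assignment, so truth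
--     in M_I (every assignment, every world) amounts to the same equation.
-- The remaining bookkeeping is that evaluating the variables x⃗ under g, and
-- the constants g(x⃗) under any assignment, both yield the vector g(x⃗).

open import Defs
open import Data.Nat using (ℕ)
open import Data.Vec using (Vec; map)
open import Data.Vec.Properties using (map-∘)
open import Data.Product using (_,_; proj₁)
open import Function.Bundles using (Equivalence; _⇔_; mk⇔)
open import Function.Properties.Equivalence using ()
  renaming (refl to ⇔-refl; sym to ⇔-sym; trans to ⇔-trans)
open import Relation.Binary.PropositionalEquality using (_≡_; refl; sym)

module Flattening (PR : MVProgram) where
  open MVProgram PR
  open Semantics PR

  eval-vars : {X : Set} {n : ℕ} (g : Assignment X) (xs : Vec X n) →
    map (eval g) (map var xs) ≡ map g xs
  eval-vars g xs = sym (map-∘ (eval g) var xs)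

  eval-cons : {X Y : Set} {n : ℕ} (g : Assignment X) (f : Y → S) (ys : Vec Y n) →
    map (eval g) (map (λ y → con (f y)) ys) ≡ map f ys
  eval-cons g f ys = sym (map-∘ (eval g) (λ y → con (f y)) ys)

  V-I-cong : {α : W} {p : Pred} {cs ds : Vec S (arity p)} →
    cs ≡ ds → V-I α p cs ⇔ V-I α p ds
  V-I-cong refl = ⇔-refl

  sat-encapsulation : {X : Set} (w : W) (g : Assignment X)
    (p : Pred) (ts : Vec (Term X) (arity p)) →
    satF w g (E p ts) ⇔ V-I w p (map (eval g) ts)
  sat-encapsulation w g p ts = mk⇔ proj₁ (λ w≡κ → w≡κ , refl)

  -- Since R_α = W × {α}, [α]φ holds at any world iff φ holds at α.
  sat-box : {X : Set} (g : Assignment X) (w α : W)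
    (p : Pred) (ts : Vec (Term X) (arity p)) →
    satI g w (box α p ts) ⇔ V-I α p (map (eval g) ts)
  sat-box g w α p ts = mk⇔ (λ h → h α refl) (λ { h .α refl → h })

  -- The direction "⇒" needs
  -- some assignment to instantiate with; S is nonempty, so one exists.
  true-box-ground : {X : Set} (α : W) (p : Pred) (ts : Vec (Term X) (arity p))
    (cs : Vec S (arity p)) → (∀ g → map (eval g) ts ≡ cs) →
    TrueI (box α p ts) ⇔ V-I α p cs
  true-box-ground {X} α p ts cs ground = mk⇔ to from
    where
    to : TrueI (box α p ts) → V-I α p cs
    to h = Equivalence.to (⇔-trans (sat-box g₀ α α p ts) (V-I-cong (ground g₀))) (h g₀ α)
      where
      g₀ : Assignment X
      g₀ _ = s₀
    from : V-I α p cs → TrueI (box α p ts)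
    from α≡I g w = Equivalence.from (⇔-trans (sat-box g w α p ts) (V-I-cong (ground g))) α≡I

open Flattening
open MVProgram
open Semantics

mainTheorem1 : (PR : MVProgram) {X : Set} (p : Pred PR) (xs : Vec X (arity PR p))
    (w : W PR) (g : X → S PR) →
    satF PR w g (E PR p (map (λ x → Term.var x) xs))
    ⇔ TrueI PR {X} (MAtom.box w p (map (λ x → Term.con (g x)) xs))
mainTheorem1 PR p xs w g =
  ⇔-trans (sat-encapsulation PR w g p (map (λ x → Term.var x) xs))
  (⇔-trans (V-I-cong PR (eval-vars PR g xs))
           (⇔-sym (true-box-ground PR w p (map (λ x → Term.con (g x)) xs) (map g xs)
                     (λ g′ → eval-cons PR g′ g xs))))
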